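{- Let $q,w,d$ be positive integers with $d$ odd, $t=\frac{2w-d+1}{2}$, and $\overline{w}=(w_1,\dots,w_{q-1})$ a composition with $\sum_i w_i=w$. Let $\mathcal{H}$ and $\mathcal{F}$ be as defined below. Then every $\mathcal{F}$-free matching $\mathcal{M}$ of $\mathcal{H}$ defines an $(n,d,\overline{w})_q$-constant composition code $C_{\mathcal{M}}\subseteq J_q(n,\overline{w})$ with $|C_{\mathcal{M}}|=|\mathcal{M}|$.
   Context: Let $\Sigma_q=\{0,\dots,q-1\}$. $J_q(n,\overline{w})$ is the set of $\mathbf{x}\in\Sigma_q^n$ having exactly $w_j$ coordinates equal to $j$ for each $j\in[q-1]$. An $(n,d,\overline{w})_q$-constant composition code is a subset of $J_q(n,\overline{w})$ whose distinct elements have pairwise Hamming distance at least $d$. For $i\in[n]$ let $V_i=\{(i,a):a\in[q-1]\}$. Let $\mathcal{J}_q(n,\overline{w})=\{\{(i,x_i):x_i\neq0\}:\mathbf{x}\in J_q(n,\overline{w})\}$, and for $e=\{(i,x_i):x_i\ne0\}$ let $\mathrm{supp}(e)=\{i:x_i\ne0\}$. The hypergraph $\mathcal{H}$ has vertex set the family of $t$-subsets of $\bigcup_{i=1}^nV_i$ and edge set $\{\binom{e}{t}:e\in\mathcal{J}_q(n,\overline{w})\}$ (where $\binom{e}{t}$ is the family of $t$-subsets of $e$). $\mathcal{F}$ is the graph with vertex set $E(\mathcal{H})$ whose edges are the pairs $\{\binom{e^1}{t},\binom{e^2}{t}\}$ with $e^1,e^2\in\mathcal{J}_q(n,\overline{w})$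 and $|\mathrm{supp}(e^1)\cap\mathrm{supp}(e^2)|>t$. A matching of $\mathcal{H}$ is a set of pairwise disjoint edges; it is $\mathcal{F}$-free if it contains no edge of $\mathcal{F}$ as a subset. -}

module Defs where

open import Data.Nat using (ℕ; zero; suc; _+_; _*_; _≤_; _<_)
open import Data.Fin using (Fin; zero; suc)
open import Data.Vec using (Vec; []; _∷_; lookup)
open import Data.Bool using (Bool; true; false)
open import Data.Product using (_×_; ∃-syntax)
open import Data.Empty using (⊥)
open import Relation.Binary.PropositionalEquality using (_≡_)
open import Relation.Nullary using (¬_; Dec; yes; no)
open import Data.Fin using (_≟_)

-- Alphabet Σ_q with q = suc r : symbols Fin (suc r); 0 = zero,
-- nonzero symbols j ∈ [q-1] are written suc a with a : Fin r.
Word : ℕ → ℕ → Set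
Word r n = Vec (Fin (suc r)) n

vsum : ∀ {k} → Vec ℕ k → ℕ
vsum [] = 0
vsum (x ∷ xs) = x + vsum xs

count : ∀ {r n} → Fin (suc r) → Word r n → ℕ
count s [] = 0
count s (y ∷ ys) with y ≟ s
... | yes _ = suc (count s ys)
... | no _ = count s ys

InJ : ∀ {r n} → Vec ℕ r → Word r n → Set
InJ {r} wbar x = (a : Fin r) → count (suc a) x ≡ lookup wbar a

dist : ∀ {r n} → Word r n → Word r n → ℕ
dist [] [] = 0
dist (x ∷ xs) (y ∷ ys) with x ≟ y
... | yes _ = dist xs ys
... | no _ = suc (dist xs ys)

isNonzero : ∀ {r} → Fin (suc r) → Bool
isNonzero zero = false
isNonzero (suc _) = true

suppMeet : ∀ {r n} → Word r n → Word r n → ℕ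
suppMeet [] [] = 0
suppMeet (x ∷ xs) (y ∷ ys) with isNonzero x | isNonzero y
... | true | true = suc (suppMeet xs ys)
... | _ | _ = suppMeet xs ys

-- Subsets of ⋃_{i∈[n]} V_i, V_i = {(i,a) : a ∈ [q-1]}, as n × r Boolean matrices:
-- entry (i,a) is true iff (i, suc a) is in the set.
PSet : ℕ → ℕ → Set
PSet r n = Vec (Vec Bool r) n

countTrue : ∀ {k} → Vec Bool k → ℕ
countTrue [] = 0
countTrue (true ∷ bs) = suc (countTrue bs)
countTrue (false ∷ bs) = countTrue bs

size : ∀ {r n} → PSet r n → ℕ
size [] = 0
size (row ∷ rows) = countTrue row + size rows

-- S ⊆ e(x) where e(x) = {(i, x_i) : x_i ≠ 0}
_⊆e_ : ∀ {r n} → PSet r n → Word r n → Set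
_⊆e_ {r} {n} S x =
  (i : Fin n) (a : Fin r) → lookup (lookup S i) a ≡ true → lookup x i ≡ suc a

-- The edge binom(e(x), t) of H, as a predicate on vertices (t-subsets):
-- S belongs to the edge iff S is a t-subset of e(x).
InEdge : ∀ {r n} → ℕ → Word r n → PSet r n → Set
InEdge t x S = (S ⊆e x) × (size S ≡ t)

DisjointEdges : ∀ {r n} → ℕ → Word r n → Word r n → Set
DisjointEdges t x y = ¬ (∃[ S ] (InEdge t x S × InEdge t y S))

-- {binom(e(x),t), binom(e(y),t)} is an edge of F
FEdge : ∀ {r n} → ℕ → Word r n → Word r n → Set
FEdge t x y = t < suppMeet x y

-- A coordinate in the support of exactly one of x, y is a disagreement; one in both
-- supports is counted twice by weight x + weight y, once as common support and once as
-- either a nonzero agreement x_i = y_i or a disagreement. For x, y ∈ J_q(n, w̄) this gives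
--   w + w = |supp x ∩ supp y| + #{i : x_i = y_i ≠ 0} + d(x, y).
-- F-freeness bounds the common support by t, and disjointness of the two edges bounds
-- the agreements by t − 1, since t agreements form a t-subset of both e(x) and e(y).
-- So d(x, y) ≥ 2w − 2t + 1 = d, and the matching itself is the code.
module Submission where

open import Defs
open import Data.Nat using (ℕ; zero; suc; _+_; _*_; _≤_; _<_; z≤n; s≤s)
open import Data.Nat.Properties
  using (+-suc; +-0-commutativeMonoid; +-cancelˡ-≤; +-mono-≤-<; +-monoˡ-≤; ≮⇒≥; ≰⇒>; module ≤-Reasoning)
open import Data.Nat.Tactic.RingSolver using (solve-∀)
open import Data.Fin using (Fin; zero; suc; _≟_)
open import Data.Fin.Properties using (suc-injective)
open import Data.Vec using (Vec; []; _∷_; lookup; replicate)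
open import Data.Vec.Properties using (lookup-replicate)
open import Data.Bool using (Bool; true; false)
open import Data.List using (List; length)
open import Data.List.Relation.Unary.All using (All; []; _∷_)
open import Data.List.Relation.Unary.AllPairs using (AllPairs; []; _∷_)
open import Data.Product using (_×_; _,_; ∃-syntax)
open import Function using (_∘_)
open import Relation.Binary.PropositionalEquality using (_≡_; _≢_; refl; sym; trans; cong; cong₂; module ≡-Reasoning)
open import Relation.Nullary using (¬_; yes; no; contradiction)
open import Algebra.Properties.CommutativeMonoid.Sum +-0-commutativeMonoid
  using (sum-cong-≗; sum-replicate-zero; ∑-distrib-+; sum-syntax)

∑-zero : ∀ {r} (f : Fin r → ℕ) → (∀ a → f a ≡ 0) → ∑[ a < r ] f a ≡ 0
∑-zero {r} f f≡0 = trans (sum-cong-≗ f≡0) (sum-replicate-zero r)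

∑-indicator : ∀ {r} (f : Fin r → ℕ) (b : Fin r) →
  f b ≡ 1 → (∀ a → a ≢ b → f a ≡ 0) → ∑[ a < r ] f a ≡ 1
∑-indicator f zero fb≡1 f≡0 = cong₂ _+_ fb≡1 (∑-zero (f ∘ suc) (λ a → f≡0 (suc a) λ ()))
∑-indicator f (suc b) fb≡1 f≡0 rewrite f≡0 zero (λ ()) =
  ∑-indicator (f ∘ suc) b fb≡1 (λ a a≢b → f≡0 (suc a) (a≢b ∘ suc-injective))

vsum≡∑lookup : ∀ {r} (v : Vec ℕ r) → vsum v ≡ ∑[ a < r ] lookup v a
vsum≡∑lookup [] = refl
vsum≡∑lookup (x ∷ v) = cong (x +_) (vsum≡∑lookup v)

count-∷ : ∀ {r n} (s y : Fin (suc r)) (ys : Word r n) →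
  count s (y ∷ ys) ≡ count s (y ∷ []) + count s ys
count-∷ s y ys with y ≟ s
... | yes _ = refl
... | no _ = refl

count-self : ∀ {r} (s : Fin (suc r)) → count s (s ∷ []) ≡ 1
count-self s with s ≟ s
... | yes _ = refl
... | no s≢s = contradiction refl s≢s

count-other : ∀ {r} (s y : Fin (suc r)) → y ≢ s → count s (y ∷ []) ≡ 0
count-other s y y≢s with y ≟ s
... | yes y≡s = contradiction y≡s y≢s
... | no _ = refl

weight : ∀ {r n} → Word r n → ℕ
weight [] = 0
weight (zero ∷ xs) = weight xs
weight (suc _ ∷ xs) = suc (weight xs)

weight-singleton : ∀ {r} (y : Fin (suc r)) → weight (y ∷ []) ≡ ∑[ a < r ] count (suc a) (y ∷ [])
weight-singleton {r} zero = sym (∑-zero {r} _ (λ a → count-other (suc a) zero λ ()))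
weight-singleton {r} (suc b) =
  sym (∑-indicator {r} _ b (count-self (suc b)) (λ a a≢b → count-other (suc a) (suc b) (a≢b ∘ sym ∘ suc-injective)))

weight≡∑count : ∀ {r n} (x : Word r n) → weight x ≡ ∑[ a < r ] count (suc a) x
weight≡∑count {r} [] = sym (sum-replicate-zero r)
weight≡∑count {r} (y ∷ ys) = begin
  weight (y ∷ ys)                                                     ≡⟨ weight-∷ y ⟩
  weight (y ∷ []) + weight ys                                         ≡⟨ cong₂ _+_ (weight-singleton y) (weight≡∑count ys) ⟩
  ∑[ a < r ] count (suc a) (y ∷ []) + ∑[ a < r ] count (suc a) ys     ≡⟨ ∑-distrib-+ (λ a → count (suc a) (y ∷ [])) (λ a → count (suc a) ys) ⟨
  ∑[ a < r ] (count (suc a) (y ∷ []) + count (suc a) ys)             ≡⟨ sum-cong-≗ (λ a → count-∷ (suc a) y ys) ⟨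
  ∑[ a < r ] count (suc a) (y ∷ ys)                                   ∎
  where
  open ≡-Reasoning
  weight-∷ : ∀ y → weight (y ∷ ys) ≡ weight (y ∷ []) + weight ys
  weight-∷ zero = refl
  weight-∷ (suc _) = refl

InJ⇒weight≡vsum : ∀ {r n} (wbar : Vec ℕ r) (x : Word r n) → InJ wbar x → weight x ≡ vsum wbar
InJ⇒weight≡vsum wbar x x∈J = trans (weight≡∑count x) (trans (sum-cong-≗ x∈J) (sym (vsum≡∑lookup wbar)))

agreements : ∀ {r n} → Word r n → Word r n → ℕ
agreements [] [] = 0
agreements (zero ∷ xs) (_ ∷ ys) = agreements xs ys
agreements (suc a ∷ xs) (y ∷ ys) with suc a ≟ y
... | yes _ = suc (agreements xs ys)
... | no _ = agreements xs ys

suppMeet+agreements+dist≡weights : ∀ {r n} (x y : Word r n) →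
  suppMeet x y + agreements x y + dist x y ≡ weight x + weight y
suppMeet+agreements+dist≡weights [] [] = refl
suppMeet+agreements+dist≡weights (zero ∷ xs) (zero ∷ ys) = suppMeet+agreements+dist≡weights xs ys
suppMeet+agreements+dist≡weights (zero ∷ xs) (suc b ∷ ys)
  rewrite +-suc (suppMeet xs ys + agreements xs ys) (dist xs ys) | +-suc (weight xs) (weight ys)
  = cong suc (suppMeet+agreements+dist≡weights xs ys)
suppMeet+agreements+dist≡weights (suc a ∷ xs) (y ∷ ys) with suc a ≟ y
suppMeet+agreements+dist≡weights (suc a ∷ xs) (.(suc a) ∷ ys) | yes refl
  rewrite +-suc (suppMeet xs ys) (agreements xs ys) | +-suc (weight xs) (weight ys)
  = cong (2 +_) (suppMeet+agreements+dist≡weights xs ys)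
suppMeet+agreements+dist≡weights (suc a ∷ xs) (zero ∷ ys) | no _
  rewrite +-suc (suppMeet xs ys + agreements xs ys) (dist xs ys)
  = cong suc (suppMeet+agreements+dist≡weights xs ys)
suppMeet+agreements+dist≡weights (suc a ∷ xs) (suc b ∷ ys) | no _
  rewrite +-suc (suppMeet xs ys + agreements xs ys) (dist xs ys) | +-suc (weight xs) (weight ys)
  = cong (2 +_) (suppMeet+agreements+dist≡weights xs ys)

emptyRow : ∀ r → Vec Bool r
emptyRow r = replicate r false

singletonRow : ∀ {r} → Fin r → Vec Bool r
singletonRow zero = true ∷ emptyRow _
singletonRow (suc a) = false ∷ singletonRow a

countTrue-emptyRow : ∀ r → countTrue (emptyRow r) ≡ 0
countTrue-emptyRow zero = refl
countTrue-emptyRow (suc r) = countTrue-emptyRow r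

countTrue-singletonRow : ∀ {r} (a : Fin r) → countTrue (singletonRow a) ≡ 1
countTrue-singletonRow {suc r} zero = cong suc (countTrue-emptyRow r)
countTrue-singletonRow (suc a) = countTrue-singletonRow a

lookup-emptyRow : ∀ {r} (a : Fin r) → lookup (emptyRow r) a ≢ true
lookup-emptyRow a rewrite lookup-replicate a false = λ ()

lookup-singletonRow : ∀ {r} (a b : Fin r) → lookup (singletonRow a) b ≡ true → a ≡ b
lookup-singletonRow zero zero _ = refl
lookup-singletonRow zero (suc b) e = contradiction e (lookup-emptyRow b)
lookup-singletonRow (suc a) (suc b) = cong suc ∘ lookup-singletonRow a b

CommonSubset : ∀ {r n} → Word r n → Word r n → ℕ → Set
CommonSubset {r} {n} x y k = ∃[ S ] (S ⊆e x × S ⊆e y × size {r} {n} S ≡ k)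

∷-emptyRow-⊆e : ∀ {r n} {S : PSet r n} {z zs} → S ⊆e zs → (emptyRow r ∷ S) ⊆e (z ∷ zs)
∷-emptyRow-⊆e S⊆zs zero a e = contradiction e (lookup-emptyRow a)
∷-emptyRow-⊆e S⊆zs (suc i) = S⊆zs i

∷-singletonRow-⊆e : ∀ {r n} {S : PSet r n} {zs} (b : Fin r) → S ⊆e zs → (singletonRow b ∷ S) ⊆e (suc b ∷ zs)
∷-singletonRow-⊆e b S⊆zs zero a e = cong suc (lookup-singletonRow b a e)
∷-singletonRow-⊆e b S⊆zs (suc i) = S⊆zs i

CommonSubset-∷ : ∀ {r n} {xs ys : Word r n} {k} (x y : Fin (suc r)) →
  CommonSubset xs ys k → CommonSubset (x ∷ xs) (y ∷ ys) k
CommonSubset-∷ {r} _ _ (S , S⊆xs , S⊆ys , |S|≡k) =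
  emptyRow r ∷ S , ∷-emptyRow-⊆e S⊆xs , ∷-emptyRow-⊆e S⊆ys , trans (cong (_+ size S) (countTrue-emptyRow r)) |S|≡k

CommonSubset-∷-agree : ∀ {r n} {xs ys : Word r n} {k} (b : Fin r) →
  CommonSubset xs ys k → CommonSubset (suc b ∷ xs) (suc b ∷ ys) (suc k)
CommonSubset-∷-agree b (S , S⊆xs , S⊆ys , |S|≡k) =
  singletonRow b ∷ S , ∷-singletonRow-⊆e b S⊆xs , ∷-singletonRow-⊆e b S⊆ys ,
  trans (cong (_+ size S) (countTrue-singletonRow b)) (cong suc |S|≡k)

commonSubset : ∀ {r n} (x y : Word r n) {k} → k ≤ agreements x y → CommonSubset x y k
commonSubset [] [] z≤n = [] , (λ ()) , (λ ()) , refl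
commonSubset (zero ∷ xs) (y ∷ ys) k≤ = CommonSubset-∷ zero y (commonSubset xs ys k≤)
commonSubset (suc a ∷ xs) (y ∷ ys) k≤ with suc a ≟ y
commonSubset (suc a ∷ xs) (y ∷ ys) k≤ | no _ = CommonSubset-∷ (suc a) y (commonSubset xs ys k≤)
commonSubset (suc a ∷ xs) (.(suc a) ∷ ys) {zero} _ | yes refl =
  CommonSubset-∷ (suc a) (suc a) (commonSubset xs ys z≤n)
commonSubset (suc a ∷ xs) (.(suc a) ∷ ys) {suc k} (s≤s k≤) | yes refl =
  CommonSubset-∷-agree a (commonSubset xs ys k≤)

disjointEdges⇒agreements< : ∀ {r n} {t} (x y : Word r n) → DisjointEdges t x y → agreements x y < t
disjointEdges⇒agreements< x y disjoint = ≰⇒> λ t≤agreements →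
  let S , S⊆x , S⊆y , |S|≡t = commonSubset x y t≤agreements
  in disjoint (S , (S⊆x , |S|≡t) , (S⊆y , |S|≡t))

distance-bound : ∀ {s a δ t d w} → s + a + δ ≡ w + w → s ≤ t → a < t → 2 * t + d ≡ 2 * w + 1 → d ≤ δ
distance-bound {s} {a} {δ} {t} {d} {w} weights s≤t a<t 2t+d≡2w+1 = +-cancelˡ-≤ (2 * t) d δ (begin
  2 * t + d        ≡⟨ 2t+d≡2w+1 ⟩
  2 * w + 1        ≡⟨ odd-double w ⟩
  suc (w + w)      ≡⟨ cong suc weights ⟨
  suc (s + a) + δ  ≤⟨ +-monoˡ-≤ δ (+-mono-≤-< s≤t a<t) ⟩
  t + t + δ        ≡⟨ cong (_+ δ) (double t) ⟨
  2 * t + δ        ∎)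
  where
  open ≤-Reasoning
  double : ∀ m → 2 * m ≡ m + m
  double = solve-∀
  odd-double : ∀ m → 2 * m + 1 ≡ suc (m + m)
  odd-double = solve-∀

matched-distance : ∀ {r n} {w d t} (wbar : Vec ℕ r) → vsum wbar ≡ w → 2 * t + d ≡ 2 * w + 1 →
  (x y : Word r n) → InJ wbar x → InJ wbar y → DisjointEdges t x y → ¬ FEdge t x y → d ≤ dist x y
matched-distance {w = w} wbar vsum≡w 2t+d≡2w+1 x y x∈J y∈J disjoint notF =
  distance-bound {w = w} weights (≮⇒≥ notF) (disjointEdges⇒agreements< x y disjoint) 2t+d≡2w+1
  where
  weight≡w : ∀ z → InJ wbar z → weight z ≡ w
  weight≡w z z∈J = trans (InJ⇒weight≡vsum wbar z z∈J) vsum≡w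
  weights : suppMeet x y + agreements x y + dist x y ≡ w + w
  weights = trans (suppMeet+agreements+dist≡weights x y) (cong₂ _+_ (weight≡w x x∈J) (weight≡w y y∈J))

module _ {a p r s u} {A : Set a} {P : A → Set p}
         {R : A → A → Set r} {S : A → A → Set s} {T : A → A → Set u}
         (combine : ∀ {x y} → P x → P y → R x y → S x y → T x y) where

  allPairs-combine : ∀ {xs} → All P xs → AllPairs R xs → AllPairs S xs → AllPairs T xs
  allPairs-combine [] [] [] = []
  allPairs-combine (px ∷ pxs) (rx ∷ rxs) (sx ∷ sxs) = row px pxs rx sx ∷ allPairs-combine pxs rxs sxs
    where
    row : ∀ {x ys} → P x → All P ys → All (R x) ys → All (S x) ys → All (T x) ys
    row px [] [] [] = []
    row px (py ∷ pys) (r ∷ rs) (s ∷ ss) = combine px py r s ∷ row px pys rs ss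

lemma4p1 : (r n w d t : ℕ) (wbar : Vec ℕ r) →
    1 ≤ w → 1 ≤ d → (∃[ k ] d ≡ suc (2 * k)) →
    2 * t + d ≡ 2 * w + 1 →
    ((a : Fin r) → 1 ≤ lookup wbar a) → vsum wbar ≡ w →
    (M : List (Word r n)) →
    All (InJ wbar) M →
    AllPairs (DisjointEdges t) M →
    AllPairs (λ (x y : Word r n) → ¬ FEdge t x y) M →
    ∃[ C ] (All {A = Word r n} (InJ wbar) C × AllPairs (λ (x y : Word r n) → d ≤ dist x y) C × length C ≡ length M)
lemma4p1 r n w d t wbar _ _ _ 2t+d≡2w+1 _ vsum≡w M M⊆J disjoint F-free =
  M , M⊆J , allPairs-combine (λ {x} {y} → matched-distance wbar vsum≡w 2t+d≡2w+1 x y) M⊆J disjoint F-free , refl
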